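{- Let $N\ge 2$, let $A_1,A_2,\ldots$ be a quasifibonacci sequence of level $N$, let $k\ge1$, let $A_k\le n<A_{k+1}$, and put $n'=A_1+A_2+\cdots+A_k-n$. Then $P_n$ and $P_{n'}$ are dual posets, i.e. there is a bijection $\phi:P_n\to P_{n'}$ with $x\le y$ in $P_n$ if and only if $\phi(y)\le\phi(x)$ in $P_{n'}$.
   Context: For an integer $N\ge 2$, a sequence $A_1,A_2,\ldots$ of positive integers is a quasifibonacci sequence of level $N$ if $A_{k+N}=A_{k+N-1}+\cdots+A_k$ for all $k\ge 1$, and $A_k>A_{k-1}+\cdots+A_1$ for all $1\le k\le N$. Let $\{0,1\}^{\omega}$ be the set of sequences $(a_1,a_2,\ldots)$ with $a_i\in\{0,1\}$ and $a_i=0$ for all but finitely many $i$. For $n\ge0$, $S_n=\{a\in\{0,1\}^{\omega}:\sum_{i}a_iA_i=n\}$. The digraph $G_n$ has vertex set $S_n$, with a directed edge $a\to b$ iff there is $j\ge1$ such that $a_{j+N}=1$, $a_j=\cdots=a_{j+N-1}=0$, $b_{j+N}=0$, $b_j=\cdots=b_{j+N-1}=1$, and $a_t=b_t$ for all $t\notin\{j,\ldots,j+N\}$. The poset $P_n$ is $S_n$ ordered by $a\ge b$ iff there is a directed path in $G_n$ from $a$ to $b$. -}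

module Defs where

open import Data.Nat using (ℕ; zero; suc; _+_; _∸_; _≤_; _<_)
open import Data.Integer using (ℤ; +_)
open import Data.Bool using (Bool; true; false; if_then_else_)
open import Data.List using (List; []; _∷_)
open import Data.Sum using (_⊎_)
open import Data.Product using (Σ; _×_; _,_; proj₁)
open import Relation.Binary.PropositionalEquality using (_≡_; refl; sym; trans)
open import Relation.Binary.Bundles using (Setoid)
open import Function.Bundles using (Func; Bijection)

-- Sequences of positive integers are functions A : ℕ → ℕ, read
-- 1-indexed: A 1, A 2, ... (the value A 0 is irrelevant).

sumFrom : (ℕ → ℕ) → ℕ → ℕ → ℕ
sumFrom A lo zero    = 0
sumFrom A lo (suc c) = A lo + sumFrom A (suc lo) c

record Quasifibonacci (N : ℕ) (A : ℕ → ℕ) : Set where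
  field
    positive   : ∀ i → 1 ≤ i → 0 < A i
    recurrence : ∀ k → 1 ≤ k → A (k + N) ≡ sumFrom A k N
    initial    : ∀ k → 1 ≤ k → k ≤ N → sumFrom A 1 (k ∸ 1) < A k

-- Elements of {0,1}^ω (finitely supported 0/1 sequences) are represented
-- by finite lists of bits: the list b₁ ∷ b₂ ∷ … ∷ bₘ ∷ [] stands for the
-- sequence (b₁, b₂, …, bₘ, 0, 0, …).  Two lists represent the same
-- sequence iff they agree pointwise (trailing zeros are irrelevant).

Word : Set
Word = List Bool

-- at a i = a_i  (1-indexed; a_0 and indices beyond the list are 0)
at : Word → ℕ → Bool
at []       _             = false
at (b ∷ bs) zero          = false
at (b ∷ bs) (suc zero)    = b
at (b ∷ bs) (suc (suc i)) = at bs (suc i)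

_≈_ : Word → Word → Set
a ≈ b = ∀ i → at a i ≡ at b i

weight : (ℕ → ℕ) → Word → ℕ → ℕ
weight A []       i = 0
weight A (b ∷ bs) i = (if b then A i else 0) + weight A bs (suc i)

value : (ℕ → ℕ) → Word → ℕ
value A a = weight A a 1

Edge : ℕ → Word → Word → Set
Edge N a b = Σ ℕ λ j → 1 ≤ j
  × at a (j + N) ≡ true
  × (∀ t → j ≤ t → t < j + N → at a t ≡ false)
  × at b (j + N) ≡ false
  × (∀ t → j ≤ t → t < j + N → at b t ≡ true)
  × (∀ t → (t < j ⊎ j + N < t) → at a t ≡ at b t)

-- Intermediate vertices automatically lie in S_n, since
-- edges preserve the value.
data Path (N : ℕ) : Word → Word → Set where
  here  : ∀ {a b} → a ≈ b → Path N a b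
  step  : ∀ {a b c} → Edge N a b → Path N b c → Path N a c

-- S_m for an integer m (S_m = ∅ when m < 0), as a setoid.

S : (ℕ → ℕ) → ℤ → Set
S A m = Σ Word λ a → + value A a ≡ m

S-setoid : (ℕ → ℕ) → ℤ → Setoid _ _
S-setoid A m = record
  { Carrier = S A m
  ; _≈_ = λ x y → proj₁ x ≈ proj₁ y
  ; isEquivalence = record
    { refl  = λ i → refl
    ; sym   = λ p i → sym (p i)
    ; trans = λ p q i → trans (p i) (q i)
    }
  }

_≤[_]_ : ∀ {A m} → S A m → ℕ → S A m → Set
x ≤[ N ] y = Path N (proj₁ y) (proj₁ x)

record Dual (N : ℕ) (A : ℕ → ℕ) (m m' : ℤ) : Set where
  field
    φ        : Bijection (S-setoid A m) (S-setoid A m')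
    reverses : ∀ x y →
      (x ≤[ N ] y → Bijection.to φ y ≤[ N ] Bijection.to φ x) ×
      (Bijection.to φ y ≤[ N ] Bijection.to φ x → x ≤[ N ] y)

module Submission where

-- The duality P_n ≅ P_{n'}ᵒᵖ is realised by complementation: if every word
-- of S_n and of S_{n'} is supported in {1,…,k}, flipping the first k bits
-- maps S_n to S_{n'} (the values of a word and of its complement add up to
-- A_1 + ⋯ + A_k = n + n') and reverses every edge of G_n, because an edge
-- replaces the pattern 0⋯01 on positions j,…,j+N by 1⋯10, which is exactly
-- the complement of the reversed edge.
--
-- It then shows that a
-- quasifibonacci sequence is monotone and satisfies
-- A_1 + ⋯ + A_m < A_{m+2}; together these force every word of value below
-- A_{k+1} to live in {1,…,k}, which is the support hypothesis needed for
-- both S_n and S_{n'} when A_k ≤ n < A_{k+1}.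

open import Defs
open import Data.Nat using (ℕ; zero; suc; _+_; _≤_; _<_; z≤n; s≤s; _≤?_; _≤′_; ≤′-refl; ≤′-step)
open import Data.Nat.Properties
open import Data.Integer using (ℤ; +_; _-_)
import Data.Integer as ℤ
import Data.Integer.Properties as ℤ
open import Algebra.Bundles using (AbelianGroup)
open import Algebra.Properties.Group (AbelianGroup.group ℤ.+-0-abelianGroup)
  using (//-rightDividesˡ; //-rightDividesʳ)
open import Algebra.Properties.CommutativeSemigroup +-commutativeSemigroup
  using (interchange)
open import Data.Bool using (true; false; not; if_then_else_)
open import Data.Bool.Properties using (not-involutive)
open import Data.List using ([]; _∷_)
open import Data.Product using (_,_; proj₁)
open import Data.Sum using (inj₂)
open import Data.Empty using (⊥-elim)
open import Relation.Nullary using (yes; no)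
open import Relation.Binary.PropositionalEquality
open import Function.Bundles using (Bijection)

tail : Word → Word
tail []       = []
tail (_ ∷ bs) = bs

at-tail : ∀ a t → at (tail a) (suc t) ≡ at a (suc (suc t))
at-tail []      t = refl
at-tail (_ ∷ _) t = refl

at-zero : ∀ a → at a 0 ≡ false
at-zero []      = refl
at-zero (_ ∷ _) = refl

Supported : ℕ → Word → Set
Supported c a = ∀ t → c < t → at a t ≡ false

Supported-tail : ∀ c a → Supported (suc c) a → Supported c (tail a)
Supported-tail c a supp zero    ()
Supported-tail c a supp (suc t) c<t = trans (at-tail a t) (supp (suc (suc t)) (s≤s c<t))

Supported-bound : ∀ c a t → Supported c a → at a t ≡ true → t ≤ c
Supported-bound c a t supp a[t] with t ≤? c
... | yes t≤c = t≤c
... | no t≰c with trans (sym (supp t (≰⇒> t≰c))) a[t]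
...   | ()

complement : ℕ → Word → Word
complement zero    a = []
complement (suc c) a = not (at a 1) ∷ complement c (tail a)

at-complement : ∀ c a t → 1 ≤ t → t ≤ c → at (complement c a) t ≡ not (at a t)
at-complement (suc c) a (suc zero)    _ _         = refl
at-complement (suc c) a (suc (suc t)) _ (s≤s t≤c) =
  trans (at-complement c (tail a) (suc t) (s≤s z≤n) t≤c) (cong not (at-tail a t))

complement-supported : ∀ c a → Supported c (complement c a)
complement-supported zero    a t             _         = refl
complement-supported (suc c) a (suc (suc t)) (s≤s c<t) =
  complement-supported c (tail a) (suc t) c<t

complement-pointwise : ∀ c a b t → at a t ≡ at b t →
  at (complement c a) t ≡ at (complement c b) t
complement-pointwise zero    a b t             _ = refl
complement-pointwise (suc c) a b zero          _ = refl
complement-pointwise (suc c) a b (suc zero)    p = cong not p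
complement-pointwise (suc c) a b (suc (suc t)) p =
  complement-pointwise c (tail a) (tail b) (suc t)
    (trans (at-tail a t) (trans p (sym (at-tail b t))))

complement-cong : ∀ c a b → a ≈ b → complement c a ≈ complement c b
complement-cong c a b a≈b t = complement-pointwise c a b t (a≈b t)

complement-involutive : ∀ c a → Supported c a → complement c (complement c a) ≈ a
complement-involutive zero    a supp zero          = sym (at-zero a)
complement-involutive zero    a supp (suc t)       = sym (supp (suc t) (s≤s z≤n))
complement-involutive (suc c) a supp zero          = sym (at-zero a)
complement-involutive (suc c) a supp (suc zero)    = not-involutive (at a 1)
complement-involutive (suc c) a supp (suc (suc t)) =
  trans (complement-involutive c (tail a) (Supported-tail c a supp) (suc t)) (at-tail a t)

complement-injective : ∀ c a b → Supported c a → Supported c b →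
  complement c a ≈ complement c b → a ≈ b
complement-injective c a b supp-a supp-b p t =
  trans (sym (complement-involutive c a supp-a t))
    (trans (complement-cong c _ _ p t) (complement-involutive c b supp-b t))

shift : (ℕ → ℕ) → ℕ → ℕ
shift A t = A (suc t)

weight-shift : ∀ A bs i → weight A bs (suc i) ≡ weight (shift A) bs i
weight-shift A []       i = refl
weight-shift A (b ∷ bs) i = cong (_+_ (if b then A (suc i) else 0)) (weight-shift A bs (suc i))

value-tail : ∀ A a →
  value A a ≡ (if at a 1 then A 1 else 0) + value (shift A) (tail a)
value-tail A []       = refl
value-tail A (b ∷ bs) = cong (_+_ (if b then A 1 else 0)) (weight-shift A bs 1)

sumFrom-shift : ∀ A lo c → sumFrom A (suc lo) c ≡ sumFrom (shift A) lo c
sumFrom-shift A lo zero    = refl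
sumFrom-shift A lo (suc c) = cong (_+_ (A (suc lo))) (sumFrom-shift A (suc lo) c)

bit-complement : ∀ b x → (if not b then x else 0) + (if b then x else 0) ≡ x
bit-complement true  x = refl
bit-complement false x = +-identityʳ x

complement-value : ∀ A c a → Supported c a →
  value A (complement c a) + value A a ≡ sumFrom A 1 c
complement-value A zero    a       supp = empty-value A a supp
  where
  empty-value : ∀ A a → Supported 0 a → value A a ≡ 0
  empty-value A []           supp = refl
  empty-value A (true ∷ bs)  supp with supp 1 (s≤s z≤n)
  ... | ()
  empty-value A (false ∷ bs) supp =
    trans (weight-shift A bs 1) (empty-value (shift A) bs
      (Supported-tail 0 (false ∷ bs) (λ t 1<t → supp t (<⇒≤ 1<t))))
complement-value A (suc c) a supp = begin
  value A (complement (suc c) a) + value A a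
    ≡⟨ cong₂ _+_ (value-tail A (complement (suc c) a)) (value-tail A a) ⟩
  (bit̄ + value A′ (complement c (tail a))) + (bit + value A′ (tail a))
    ≡⟨ interchange bit̄ _ bit _ ⟩
  (bit̄ + bit) + (value A′ (complement c (tail a)) + value A′ (tail a))
    ≡⟨ cong₂ _+_ (bit-complement (at a 1) (A 1))
         (complement-value A′ c (tail a) (Supported-tail c a supp)) ⟩
  A 1 + sumFrom A′ 1 c
    ≡⟨ cong (_+_ (A 1)) (sym (sumFrom-shift A 1 c)) ⟩
  sumFrom A 1 (suc c) ∎
  where
  open ≡-Reasoning
  A′ : ℕ → ℕ
  A′ = shift A
  bit bit̄ : ℕ
  bit  = if at a 1 then A 1 else 0
  bit̄ = if not (at a 1) then A 1 else 0

term≤value : ∀ A a t → 1 ≤ t → at a t ≡ true → A t ≤ value A a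
term≤value A (true ∷ bs)  (suc zero)    _ _    = m≤m+n (A 1) _
term≤value A (b ∷ bs)     (suc (suc t)) _ a[t] = begin
  A (suc (suc t))            ≤⟨ term≤value (shift A) bs (suc t) (s≤s z≤n) a[t] ⟩
  value (shift A) bs         ≡⟨ weight-shift A bs 1 ⟨
  weight A bs 2              ≤⟨ m≤n+m _ _ ⟩
  value A (b ∷ bs)           ∎
  where open ≤-Reasoning

small-value-supported : ∀ A c a → (∀ t → suc c ≤ t → A (suc c) ≤ A t) →
  value A a < A (suc c) → Supported c a
small-value-supported A c a mono small t c<t with at a t in a[t]
... | false = refl
... | true  = ⊥-elim (<⇒≱ small
                (≤-trans (mono t c<t) (term≤value A a t (≤-trans (s≤s z≤n) c<t) a[t])))

module _ {N : ℕ} where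

  edge-respˡ : ∀ a a′ b → a′ ≈ a → Edge N a b → Edge N a′ b
  edge-respˡ a a′ b p (j , 1≤j , a-top , a-low , b-top , b-low , rest) =
    j , 1≤j , trans (p _) a-top , (λ t l u → trans (p t) (a-low t l u)) ,
    b-top , b-low , (λ t o → trans (p t) (rest t o))

  path-respˡ : ∀ {a a′ b} → a′ ≈ a → Path N a b → Path N a′ b
  path-respˡ p (here r)                    = here (λ i → trans (p i) (r i))
  path-respˡ {a} {a′} p (step {b = m} e r) = step (edge-respˡ a a′ m p e) r

  path-respʳ : ∀ {a b b′} → b ≈ b′ → Path N a b → Path N a b′
  path-respʳ q (here r)   = here (λ i → trans (r i) (q i))
  path-respʳ q (step e r) = step e (path-respʳ q r)

  path-snoc : ∀ {a b c} → Path N a b → Edge N b c → Path N a c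
  path-snoc {a} {b} {c} (here p) e = step {b = c} (edge-respˡ b a c p e) (here (λ _ → refl))
  path-snoc (step e p) f = step e (path-snoc p f)

  -- An edge only touches positions up to j+N, where its source has a one.
  edge-supported : ∀ c a b → Supported c a → Edge N a b → Supported c b
  edge-supported c a b supp (j , _ , a-top , _ , _ , _ , rest) t c<t =
    trans (sym (rest t (inj₂ (≤-<-trans (Supported-bound c a (j + N) supp a-top) c<t))))
      (supp t c<t)

  edge-complement : ∀ c a b → Supported c a → Edge N a b →
    Edge N (complement c b) (complement c a)
  edge-complement c a b supp (j , 1≤j , a-top , a-low , b-top , b-low , rest) =
    j , 1≤j ,
    trans (at-complement c b (j + N) 1≤j+N j+N≤c) (cong not b-top) ,
    (λ t l u → trans (at-complement c b t (≤-trans 1≤j l) (≤-trans (<⇒≤ u) j+N≤c))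
                 (cong not (b-low t l u))) ,
    trans (at-complement c a (j + N) 1≤j+N j+N≤c) (cong not a-top) ,
    (λ t l u → trans (at-complement c a t (≤-trans 1≤j l) (≤-trans (<⇒≤ u) j+N≤c))
                 (cong not (a-low t l u))) ,
    (λ t o → complement-pointwise c b a t (sym (rest t o)))
    where
    j+N≤c : j + N ≤ c
    j+N≤c = Supported-bound c a (j + N) supp a-top
    1≤j+N : 1 ≤ j + N
    1≤j+N = ≤-trans 1≤j (m≤m+n j N)

  path-complement : ∀ c {a b} → Supported c a → Path N a b →
    Path N (complement c b) (complement c a)
  path-complement c supp (here p)   = here (complement-cong c _ _ (λ i → sym (p i)))
  path-complement c {a} supp (step {b = m} e p) =
    path-snoc (path-complement c (edge-supported c a m supp e) p) (edge-complement c a m supp e)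

sum⇒difference : ∀ x y z → x ℤ.+ y ≡ z → x ≡ z - y
sum⇒difference x y z x+y≡z = trans (sym (//-rightDividesʳ y x)) (cong (_- y) x+y≡z)

difference⇒sum : ∀ x y z → x ≡ z - y → x ℤ.+ y ≡ z
difference⇒sum x y z x≡z-y = trans (cong (ℤ._+ y) x≡z-y) (//-rightDividesˡ y z)

complement-duality : ∀ N A c (m : ℤ) →
  (∀ (x : S A m) → Supported c (proj₁ x)) →
  (∀ (y : S A (+ sumFrom A 1 c - m)) → Supported c (proj₁ y)) →
  Dual N A m (+ sumFrom A 1 c - m)
complement-duality N A c m supp supp′ = record
  { φ        = φ
  ; reverses = λ x y → reverse x y , unreverse x y
  }
  where
  s : ℤ
  s = + sumFrom A 1 c

  complement-difference : ∀ a → Supported c a → + value A (complement c a) ≡ s - + value A a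
  complement-difference a supp-a =
    sum⇒difference (+ value A (complement c a)) (+ value A a) s
      (cong +_ (complement-value A c a supp-a))

  to : S A m → S A (s - m)
  to (a , a∈S) = complement c a ,
    trans (complement-difference a (supp (a , a∈S))) (cong (s -_) a∈S)

  from : S A (s - m) → S A m
  from (a , a∈S′) = complement c a ,
    trans (complement-difference a (supp′ (a , a∈S′)))
      (sym (sum⇒difference m (+ value A a) s
        (trans (ℤ.+-comm m (+ value A a)) (difference⇒sum (+ value A a) m s a∈S′))))

  φ : Bijection (S-setoid A m) (S-setoid A (s - m))
  φ = record
    { to        = to
    ; cong      = λ {x} {y} → complement-cong c (proj₁ x) (proj₁ y)
    ; bijective =
        (λ {x} {y} → complement-injective c (proj₁ x) (proj₁ y) (supp x) (supp y)) ,
        (λ y → from y , λ {z} z≈ i →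
           trans (complement-cong c (proj₁ z) _ z≈ i)
             (complement-involutive c (proj₁ y) (supp′ y) i))
    }

  reverse : ∀ x y → x ≤[ N ] y → to y ≤[ N ] to x
  reverse x y = path-complement c (supp y)

  unreverse : ∀ x y → to y ≤[ N ] to x → x ≤[ N ] y
  unreverse (a , a∈S) (b , b∈S) p =
    path-respˡ (λ i → sym (complement-involutive c b (supp (b , b∈S)) i))
      (path-respʳ (complement-involutive c a (supp (a , a∈S)))
        (path-complement c (complement-supported c a) p))

sumFrom-snoc : ∀ A lo c → sumFrom A lo (suc c) ≡ sumFrom A lo c + A (lo + c)
sumFrom-snoc A lo zero    = trans (+-identityʳ _) (cong A (sym (+-identityʳ lo)))
sumFrom-snoc A lo (suc c) = begin
  A lo + sumFrom A (suc lo) (suc c)               ≡⟨ cong (_+_ (A lo)) (sumFrom-snoc A (suc lo) c) ⟩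
  A lo + (sumFrom A (suc lo) c + A (suc lo + c))  ≡⟨ +-assoc (A lo) _ _ ⟨
  sumFrom A lo (suc c) + A (suc lo + c)            ≡⟨ cong (λ i → sumFrom A lo (suc c) + A i) (+-suc lo c) ⟨
  sumFrom A lo (suc c) + A (lo + suc c)            ∎
  where open ≡-Reasoning

last-two≤sumFrom : ∀ A lo c → A (lo + c) + A (suc (lo + c)) ≤ sumFrom A lo (suc (suc c))
last-two≤sumFrom A lo c = begin
  A (lo + c) + A (suc (lo + c))                   ≡⟨ cong (λ i → A (lo + c) + A i) (+-suc lo c) ⟨
  A (lo + c) + A (lo + suc c)                     ≤⟨ +-monoˡ-≤ _ (m≤n+m _ (sumFrom A lo c)) ⟩
  (sumFrom A lo c + A (lo + c)) + A (lo + suc c)  ≡⟨ cong (_+ A (lo + suc c)) (sumFrom-snoc A lo c) ⟨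
  sumFrom A lo (suc c) + A (lo + suc c)           ≡⟨ sumFrom-snoc A lo (suc c) ⟨
  sumFrom A lo (suc (suc c))                      ∎
  where open ≤-Reasoning

module Growth (N₂ : ℕ) (A : ℕ → ℕ) (qf : Quasifibonacci (suc (suc N₂)) A) where
  open Quasifibonacci qf

  Grows : ℕ → Set
  Grows i = A i + A (suc i) ≤ A (suc (suc i))

  -- Beyond the initial segment each term dominates the sum of the two
  -- preceding ones, since N ≥ 2 terms are summed.
  grows : ∀ i → N₂ < i → Grows i
  grows i N₂<i with m≤n⇒∃[o]m+o≡n N₂<i
  ... | o , refl = subst Grows (cong suc (+-comm o N₂)) recurrence-grows
    where
    recurrence-grows : Grows (suc o + N₂)
    recurrence-grows = subst (A (suc o + N₂) + A (suc (suc o + N₂)) ≤_)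
      (trans (sym (recurrence (suc o) (s≤s z≤n)))
        (cong A (trans (+-suc (suc o) (suc N₂)) (cong suc (+-suc (suc o) N₂)))))
      (last-two≤sumFrom A (suc o) N₂)

  -- On the initial segment this follows from A_{t+1} > A_1 + ⋯ + A_t.
  step-monotone : ∀ t → 1 ≤ t → A t ≤ A (suc t)
  step-monotone (suc t) _ with suc (suc t) ≤? suc (suc N₂)
  ... | yes t+2≤N = <⇒≤ (≤-<-trans (last≤sumFrom t) (initial (suc (suc t)) (s≤s z≤n) t+2≤N))
    where
    last≤sumFrom : ∀ t → A (suc t) ≤ sumFrom A 1 (suc t)
    last≤sumFrom t = subst (A (suc t) ≤_) (sym (sumFrom-snoc A 1 t)) (m≤n+m _ _)
  ... | no t+2≰N = ≤-trans (m≤n+m _ (A t)) (grows t (≤-pred (≤-pred (≰⇒> t+2≰N))))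

  monotone : ∀ {i t} → 1 ≤ i → i ≤ t → A i ≤ A t
  monotone {i} 1≤i i≤t = go (≤⇒≤′ i≤t)
    where
    go : ∀ {t} → i ≤′ t → A i ≤ A t
    go ≤′-refl        = ≤-refl
    go (≤′-step i≤′t) = ≤-trans (go i≤′t) (step-monotone _ (≤-trans 1≤i (≤′⇒≤ i≤′t)))

  -- A_1 + ⋯ + A_m < A_{m+2}: from the initial condition while m+2 ≤ N,
  -- and inductively from 'grows' afterwards.
  prefix-bound : ∀ m → sumFrom A 1 m < A (suc (suc m))
  prefix-bound zero    = positive 2 (s≤s z≤n)
  prefix-bound (suc m) with suc (suc (suc m)) ≤? suc (suc N₂)
  ... | yes m+3≤N = ≤-<-trans
          (subst (sumFrom A 1 (suc m) ≤_) (sym (sumFrom-snoc A 1 (suc m))) (m≤m+n _ _))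
          (initial (suc (suc (suc m))) (s≤s z≤n) m+3≤N)
  ... | no m+3≰N = begin-strict
    sumFrom A 1 (suc m)            ≡⟨ sumFrom-snoc A 1 m ⟩
    sumFrom A 1 m + A (suc m)      <⟨ +-monoˡ-< (A (suc m)) (prefix-bound m) ⟩
    A (suc (suc m)) + A (suc m)    ≡⟨ +-comm (A (suc (suc m))) (A (suc m)) ⟩
    A (suc m) + A (suc (suc m))    ≤⟨ grows (suc m) (≤-pred (≤-pred (≰⇒> m+3≰N))) ⟩
    A (suc (suc (suc m)))          ∎
    where open ≤-Reasoning

  below-next-supported : ∀ k a → value A a < A (suc k) → Supported k a
  below-next-supported k a =
    small-value-supported A k a (λ t → monotone (s≤s z≤n))

proposition4p1 : (N : ℕ) → 2 ≤ N → (A : ℕ → ℕ) → Quasifibonacci N A →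
    (k : ℕ) → 1 ≤ k → (n : ℕ) → A k ≤ n → n < A (suc k) →
    Dual N A (+ n) (+ sumFrom A 1 k - + n)
proposition4p1 zero          ()        _ _ _       _  _ _   _
proposition4p1 (suc zero)    (s≤s ())  _ _ _       _  _ _   _
proposition4p1 (suc (suc N₂)) _        _ _ zero    () _ _   _
proposition4p1 (suc (suc N₂)) _        A qf (suc k₀) _ n Ak≤n n<Ak+1 =
  complement-duality (suc (suc N₂)) A (suc k₀) (+ n) supported supported′
  where
  open Growth N₂ A qf

  supported : ∀ (x : S A (+ n)) → Supported (suc k₀) (proj₁ x)
  supported (a , a∈S) =
    below-next-supported (suc k₀) a (subst (_< A (suc (suc k₀))) (sym (ℤ.+-injective a∈S)) n<Ak+1)

  -- value a = A_1 + ⋯ + A_k − n ≤ A_1 + ⋯ + A_{k-1} < A_{k+1}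
  supported′ : ∀ (y : S A (+ sumFrom A 1 (suc k₀) - + n)) → Supported (suc k₀) (proj₁ y)
  supported′ (a , a∈S′) = below-next-supported (suc k₀) a (≤-<-trans value≤ (prefix-bound k₀))
    where
    value+n : value A a + n ≡ sumFrom A 1 k₀ + A (suc k₀)
    value+n = trans
      (ℤ.+-injective (difference⇒sum (+ value A a) (+ n) (+ sumFrom A 1 (suc k₀)) a∈S′))
      (sumFrom-snoc A 1 k₀)
    value≤ : value A a ≤ sumFrom A 1 k₀
    value≤ = +-cancelʳ-≤ (A (suc k₀)) _ _ (≤-trans (+-monoʳ-≤ (value A a) Ak≤n) (≤-reflexive value+n))
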